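{- Let $n$ be a positive integer and $\vec u,\vec v\in\mathcal H(n)$ with $\vec u$ an ancestor of $\vec v$. Then $\vec u<_{SL}\vec v$.
   Context: A hyperbinary expansion of a positive integer $n$ is a word $x_1\cdots x_k$ over $\{0,1,2\}$ with $x_1\neq 0$ and $n=\sum_{i=1}^k x_i2^{k-i}$; $\mathcal H(n)$ is the set of these. Words are regarded up to leading zeros. Single-step reductions are: (I) $2\vec y \to 1\,0\,\vec y$; (II) $\vec x\,0\,2\,\vec y\to \vec x\,1\,0\,\vec y$; (III) $\vec x\,1\,2\,\vec y \twoheadrightarrow \vec x\,2\,0\,\vec y$, for words $\vec x,\vec y$ over $\{0,1,2\}$. $\vec u$ is an ancestor of $\vec v$ if $\vec v$ is obtained from $\vec u$ by a finite positive number of single-step reductions. $<_{SL}$ is the shortlex order: words are compared first by length (shorter first), and words of equal length lexicographically (with $0<1<2$). -}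

module Defs where

open import Data.Nat using (ℕ; zero; suc; _+_; _*_; _<_)
open import Data.Fin as Fin using (Fin; toℕ)
open import Data.List using (List; []; _∷_; _++_; length; foldl)
open import Data.Product using (Σ; ∃; _×_; _,_)
open import Data.Sum using (_⊎_)
open import Relation.Binary.PropositionalEquality using (_≡_; _≢_)
open import Relation.Binary.Construct.Closure.Transitive using (TransClosure)

Digit : Set
Digit = Fin 3

d0 d1 d2 : Digit
d0 = Fin.zero
d1 = Fin.suc Fin.zero
d2 = Fin.suc (Fin.suc Fin.zero)

Word : Set
Word = List Digit

val : Word → ℕ
val = foldl (λ acc d → 2 * acc + toℕ d) 0

data LeadingNonzero : Word → Set where
  lead : ∀ {x xs} → x ≢ d0 → LeadingNonzero (x ∷ xs)

HB : ℕ → Word → Set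
HB n w = LeadingNonzero w × val w ≡ n

-- strip leading zeros (words are regarded up to leading zeros)
strip : Word → Word
strip [] = []
strip (Fin.zero ∷ xs) = strip xs
strip (x@(Fin.suc _) ∷ xs) = x ∷ xs

data Step : Word → Word → Set where
  ruleI   : ∀ y → Step (d2 ∷ y) (d1 ∷ d0 ∷ y)
  ruleII  : ∀ x y → Step (x ++ d0 ∷ d2 ∷ y) (x ++ d1 ∷ d0 ∷ y)
  ruleIII : ∀ x y → Step (x ++ d1 ∷ d2 ∷ y) (x ++ d2 ∷ d0 ∷ y)

Reduces : Word → Word → Set
Reduces u v = Σ Word λ u' → Σ Word λ v' →
  Step u' v' × strip u' ≡ strip u × strip v' ≡ strip v

Ancestor : Word → Word → Set
Ancestor = TransClosure Reduces

data LexLt : Word → Word → Set where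
  here  : ∀ {a b xs ys} → toℕ a < toℕ b → LexLt (a ∷ xs) (b ∷ ys)
  there : ∀ {a xs ys} → LexLt xs ys → LexLt (a ∷ xs) (a ∷ ys)

_<SL_ : Word → Word → Set
u <SL v = length u < length v ⊎ (length u ≡ length v × LexLt u v)

-- Each reduction rule either shortens a word (rule I, and rule II applied at the
-- front, where 0 2 ⋯ is really the shorter 2 ⋯) or keeps its length and raises
-- the first changed digit (02 → 10, 12 → 20).  Since shortlex is a strict order
-- compatible with common prefixes, every reduction, and hence every chain of
-- reductions, increases a word in shortlex order; hyperbinary expansions have
-- no leading zeros, so stripping them changes nothing.
module Submission where

open import Defs
open import Data.Nat using (ℕ; NonZero; suc; _<_; s≤s; z≤n)
open import Data.Nat.Properties using (<-trans; n<1+n)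
import Data.Fin as Fin
open import Data.List using ([]; _∷_; _++_; length)
open import Data.Product using (_,_)
open import Data.Sum using (inj₁; inj₂)
open import Data.Empty using (⊥-elim)
open import Relation.Binary.PropositionalEquality
  using (_≡_; refl; sym; trans; cong; subst; subst₂)
open import Relation.Binary.Construct.Closure.Transitive using ([_]; _∷_)

LexLt-trans : ∀ {u v w} → LexLt u v → LexLt v w → LexLt u w
LexLt-trans (here p)  (here q)  = here (<-trans p q)
LexLt-trans (here p)  (there _) = here p
LexLt-trans (there _) (here q)  = here q
LexLt-trans (there p) (there q) = there (LexLt-trans p q)

<SL-trans : ∀ {u v w} → u <SL v → v <SL w → u <SL w
<SL-trans (inj₁ p) (inj₁ q) = inj₁ (<-trans p q)
<SL-trans {u} (inj₁ p) (inj₂ (e , _)) = inj₁ (subst (length u <_) e p)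
<SL-trans {w = w} (inj₂ (e , _)) (inj₁ q) = inj₁ (subst (_< length w) (sym e) q)
<SL-trans (inj₂ (e , p)) (inj₂ (e′ , q)) = inj₂ (trans e e′ , LexLt-trans p q)

∷⁺-<SL : ∀ {u v} a → u <SL v → (a ∷ u) <SL (a ∷ v)
∷⁺-<SL a (inj₁ p)       = inj₁ (s≤s p)
∷⁺-<SL a (inj₂ (e , p)) = inj₂ (cong suc e , there p)

++⁺-<SL : ∀ {u v} x → u <SL v → (x ++ u) <SL (x ++ v)
++⁺-<SL []      p = p
++⁺-<SL (a ∷ x) p = ∷⁺-<SL a (++⁺-<SL x p)

-- A prefix x either consists of zeros, which strip removes, or puts a nonzero
-- digit in front, after which strip is the identity.
strip-++⁺-<SL : ∀ {u v} x → u <SL v → strip u <SL strip v →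
                strip (x ++ u) <SL strip (x ++ v)
strip-++⁺-<SL []              _ q = q
strip-++⁺-<SL (Fin.zero  ∷ x) p q = strip-++⁺-<SL x p q
strip-++⁺-<SL (Fin.suc k ∷ x) p _ = ++⁺-<SL (Fin.suc k ∷ x) p

strip-Step-<SL : ∀ {u v} → Step u v → strip u <SL strip v
strip-Step-<SL (ruleI y)     = inj₁ (n<1+n _)
strip-Step-<SL (ruleII x y)  =
  strip-++⁺-<SL x (inj₂ (refl , here (s≤s z≤n))) (inj₁ (n<1+n _))
strip-Step-<SL (ruleIII x y) =
  strip-++⁺-<SL x (inj₂ (refl , here (s≤s (s≤s z≤n)))) (inj₂ (refl , here (s≤s (s≤s z≤n))))

strip-Reduces-<SL : ∀ {u v} → Reduces u v → strip u <SL strip v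
strip-Reduces-<SL (_ , _ , s , eu , ev) = subst₂ _<SL_ eu ev (strip-Step-<SL s)

strip-Ancestor-<SL : ∀ {u v} → Ancestor u v → strip u <SL strip v
strip-Ancestor-<SL {u} {v} [ r ] = strip-Reduces-<SL {u} {v} r
strip-Ancestor-<SL {u} {v} (_∷_ {y = w} r rs) =
  <SL-trans {v = strip w} (strip-Reduces-<SL {u} {w} r) (strip-Ancestor-<SL {w} {v} rs)

strip-LeadingNonzero : ∀ {w} → LeadingNonzero w → strip w ≡ w
strip-LeadingNonzero (lead {Fin.zero}  x≢0) = ⊥-elim (x≢0 refl)
strip-LeadingNonzero (lead {Fin.suc _} _)   = refl

proposition2p6 : (n : ℕ) → .{{_ : NonZero n}} → (u v : Word) →
    HB n u → HB n v → Ancestor u v → u <SL v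
proposition2p6 n u v (u-lead , _) (v-lead , _) u→⁺v =
  subst₂ _<SL_ (strip-LeadingNonzero u-lead) (strip-LeadingNonzero v-lead)
    (strip-Ancestor-<SL u→⁺v)
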